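{- Let $\varphi$ be an $\mathrm{FO}^2_{\mathrm{MOD}}$ formula in normal form, with moduli $l_1,\dots,l_m$, interpreted over finite words or finite trees, and let $\mathfrak{M}$ be a finite word (respectively finite tree). Then $\mathfrak{M}\models\varphi$ if and only if every $(l_1,\dots,l_m)$-full type realized in $\mathfrak{M}$ is $\varphi$-consistent.
   Context: Setting: signature $\tau=\tau_0\cup\tau_{nav}$, $\tau_0$ unary symbols. Over finite words, $\tau_{nav}=\{\leq,\mathit{succ}\}$ (position order and successor); over finite unranked ordered trees, $\tau_{nav}=\{{\downarrow},{\downarrow^{+}},{\rightarrow},{\rightarrow^{+}}\}$ (child, descendant, immediate right sibling, following sibling); elements carry arbitrary subsets of $\tau_0$. $\mathrm{FO}^2_{\mathrm{MOD}}$: two-variable first-order logic with modulo quantifiers $\exists^{\bowtie k,l}$ ($\bowtie\in\{\leq,=,\geq\}$, $l\geq1$, $0\le k<l$), where $\mathfrak{M},a\models \exists^{\bowtie k,l} y\,\phi(x,y)$ iff $(|\{b:\mathfrak{M}\models\phi[a,b]\}|\bmod l)\bowtie k$. Normal form: $\varphi=\forall x\forall y\,\chi(x,y)\wedge\bigwedge_{i=1}^n\forall x\exists y\,\chi_i(x,y)\wedge\bigwedge_{j=1}^m\forall x\,\exists^{\bowtie_j k_j,l_j}y\,\psi_j(x,y)$ with $n,m\ge1$, $\bowtie_j\in\{\leq,\geq\}$, $\chi,\chi_i,\psi_j$ quantifier-free. Order formulas. For words, $\Theta$ consists of five formulas: $\theta_=: x=y$; $\theta_{+1}:\mathit{succ}(x,y)$;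 $\theta_{ -1}:\mathit{succ}(y,x)$; $\theta_{\ll}: x\neq y\wedge\neg\mathit{succ}(x,y)\wedge x\leq y$; $\theta_{\gg}: x\neq y\wedge\neg\mathit{succ}(y,x)\wedge y\le x$. For trees, $\Theta$ consists of ten formulas: $\theta_{\downarrow}: x{\downarrow}y$; $\theta_{\uparrow}: y{\downarrow}x$; $\theta_{\downarrow\downarrow^+}: x{\downarrow^{+}}y\wedge\neg x{\downarrow}y$; $\theta_{\uparrow\uparrow^+}: y{\downarrow^{+}}x\wedge\neg y{\downarrow}x$; $\theta_{\rightarrow}: x{\rightarrow}y$; $\theta_{\leftarrow}: y{\rightarrow}x$; $\theta_{\rightrightarrows^+}: x{\rightarrow^{+}}y\wedge\neg x{\rightarrow}y$; $\theta_{\leftleftarrows^+}: y{\rightarrow^{+}}x\wedge\neg y{\rightarrow}x$; $\theta_{\not\sim}$: $x$ and $y$ are related by none of the navigational predicates (free position); $\theta_=: x=y$. An atomic 1-type is a maximal satisfiable set of atoms and negated atoms over $\tau$ in the variable $x$; let $\boldsymbol{\alpha}$ be the set of all 1-types and $\mathrm{tp}(w)$ the 1-type realized by $w$. An $(l_1,\dots,l_m)$-full type is a function $\bar\alpha:\Theta\to\boldsymbol{\alpha}\to\{0,1\}\times\mathbb{Z}_{l_1}\times\dots\times\mathbb{Z}_{l_m}$ (subject to some structural conditions satisfied by all realized ones). The full type realized by $v\in M$ is the $\bar\alpha$ with $\bar\alpha(\theta)(\beta)=(c(W), W\bmod l_1,\dots,W\bmod l_m)$ where $W=|\{w\in M:\mathfrak{M}\models\theta[v,w],\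 \mathrm{tp}(w)=\beta\}|$ and $c(W)=0$ if $W=0$ and $1$ otherwise. Write $\pi_0,\pi_1,\dots,\pi_m$ for the components of the tuple $\bar\alpha(\theta)(\beta)$ (with $\pi_0$ the $0$–$1$ component and $\pi_j$ the component modulo $l_j$). Let $\alpha$ be the 1-type with $\bar\alpha(\theta_=)(\alpha)=(1,1,\dots,1)$. Then $\bar\alpha$ is $\varphi$-consistent if: (1) for all $\theta\in\Theta$, $\beta\in\boldsymbol{\alpha}$ with $\bar\alpha(\theta)(\beta)\neq(0,\dots,0)$, $\alpha(x)\wedge\beta(y)\wedge\theta(x,y)\models\chi(x,y)$; (2) for each $1\le i\le n$ there are $\theta\in\Theta$, $\beta\in\boldsymbol{\alpha}$ with $\bar\alpha(\theta)(\beta)\ne(0,\dots,0)$ and $\alpha(x)\wedge\beta(y)\wedge\theta(x,y)\models\chi_i(x,y)$; (3) for each $1\le j\le m$, $\big(\sum\pi_j(\bar\alpha(\theta)(\beta))\big)\bmod l_j\ \bowtie_j\ k_j$, the sum ranging over all $\theta\in\Theta,\beta\in\boldsymbol{\alpha}$ with $\alpha(x)\wedge\beta(y)\wedge\theta(x,y)\models\psi_j(x,y)$. -}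

module Defs where

open import Data.Bool using (Bool; true; false; _∧_; _∨_; not; if_then_else_)
open import Data.Nat using (ℕ; zero; suc; _+_; _≤_; _<_; _≡ᵇ_; _<ᵇ_; _≤ᵇ_; _%_)
open import Data.Fin using (Fin; toℕ)
open import Data.List using (List; []; _∷_; _++_; map; length; allFin; concatMap; lookup)
open import Data.Nat.ListAction using (sum)
open import Data.Vec using (Vec; []; _∷_)
open import Data.Vec.Properties using (≡-dec)
import Data.Bool.Properties as BoolP
open import Data.Product using (Σ; ∃; _×_; _,_; proj₁; proj₂)
open import Data.Sum using (_⊎_)
open import Relation.Nullary using (Dec; does; ¬_)
open import Relation.Binary.PropositionalEquality using (_≡_)

-- Unary signature τ₀ = Fin p.  An atomic 1-type is determined by which
-- unary symbols hold (the binary atoms on (x,x) are fixed in every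
-- word/tree), so 1-types are represented as Vec Bool p.

OneType : ℕ → Set
OneType p = Vec Bool p

allTypes : (p : ℕ) → List (OneType p)
allTypes zero    = [] ∷ []
allTypes (suc p) = map (true ∷_) (allTypes p) ++ map (false ∷_) (allTypes p)

_==ᵗ_ : ∀ {p} → OneType p → OneType p → Bool
a ==ᵗ b = does (≡-dec BoolP._≟_ a b)

record Structure (p : ℕ) (Nav : Set) : Set where
  field
    N   : ℕ
    lab : Fin N → OneType p
    rel : Nav → Fin N → Fin N → Bool

open Structure public

count : ∀ {N} → (Fin N → Bool) → ℕ
count {N} f = sum (map (λ w → if f w then 1 else 0) (allFin N))

data Var : Set where
  vx vy : Var

data QF (p : ℕ) (Nav : Set) : Set where
  un   : Fin p → Var → QF p Nav
  nav  : Nav → Var → Var → QF p Nav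
  eq   : Var → Var → QF p Nav
  tt   : QF p Nav
  neg  : QF p Nav → QF p Nav
  and  : QF p Nav → QF p Nav → QF p Nav
  or   : QF p Nav → QF p Nav → QF p Nav

lookupV : ∀ {A : Set} {n} → Vec A n → Fin n → A
lookupV (a ∷ _)  Fin.zero    = a
lookupV (_ ∷ as) (Fin.suc i) = lookupV as i

finEq : ∀ {N} → Fin N → Fin N → Bool
finEq a b = toℕ a ≡ᵇ toℕ b

eval : ∀ {p Nav} (M : Structure p Nav) → Fin (N M) → Fin (N M) → QF p Nav → Bool
eval M a b φ = go φ
  where
  val : Var → Fin (N M)
  val vx = a
  val vy = b
  go : QF _ _ → Bool
  go (un P v)    = lookupV (lab M (val v)) P
  go (nav R u v) = rel M R (val u) (val v)
  go (eq u v)    = finEq (val u) (val v)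
  go tt          = true
  go (neg φ)     = not (go φ)
  go (and φ ψ)   = go φ ∧ go ψ
  go (or φ ψ)    = go φ ∨ go ψ

data WNav : Set where
  leq succ : WNav

Word : ℕ → Set
Word p = List (OneType p)

wordStr : ∀ {p} → Word p → Structure p WNav
wordStr w = record
  { N   = length w
  ; lab = lookup w
  ; rel = λ { leq a b → toℕ a ≤ᵇ toℕ b ; succ a b → suc (toℕ a) ≡ᵇ toℕ b } }

data WΘ : Set where
  θ= θ+1 θ-1 θ≪ θ≫ : WΘ

wθ : ∀ {p} → WΘ → QF p WNav
wθ θ=  = eq vx vy
wθ θ+1 = nav succ vx vy
wθ θ-1 = nav succ vy vx
wθ θ≪  = and (neg (eq vx vy)) (and (neg (nav succ vx vy)) (nav leq vx vy))
wθ θ≫  = and (neg (eq vx vy)) (and (neg (nav succ vy vx)) (nav leq vy vx))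

-- Finite unranked ordered trees; nodes are addressed by the list of
-- child indices on the path from the root.

data Tree (p : ℕ) : Set where
  node : OneType p → List (Tree p) → Tree p

Address : Set
Address = List ℕ

mutual
  nodes : ∀ {p} → Tree p → List (Address × OneType p)
  nodes (node a ts) = ([] , a) ∷ nodesL 0 ts

  nodesL : ∀ {p} → ℕ → List (Tree p) → List (Address × OneType p)
  nodesL i []       = []
  nodesL i (t ∷ ts) = map (λ { (u , a) → (i ∷ u , a) }) (nodes t) ++ nodesL (suc i) ts

isPrefix : Address → Address → Bool
isPrefix []       _        = true
isPrefix (_ ∷ _)  []       = false
isPrefix (a ∷ as) (b ∷ bs) = (a ≡ᵇ b) ∧ isPrefix as bs

-- same parent, last indices related by R
sib : (ℕ → ℕ → Bool) → Address → Address → Bool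
sib R (a ∷ [])       (b ∷ [])       = R a b
sib R (a ∷ a' ∷ as) (b ∷ b' ∷ bs) = (a ≡ᵇ b) ∧ sib R (a' ∷ as) (b' ∷ bs)
sib R _ _ = false

data TNav : Set where
  child desc next foll : TNav

tRel : TNav → Address → Address → Bool
tRel child x y = isPrefix x y ∧ (length y ≡ᵇ suc (length x))
tRel desc  x y = isPrefix x y ∧ (length x <ᵇ length y)
tRel next  x y = sib (λ i j → suc i ≡ᵇ j) x y
tRel foll  x y = sib _<ᵇ_ x y

treeStr : ∀ {p} → Tree p → Structure p TNav
treeStr t = record
  { N   = length (nodes t)
  ; lab = λ v → proj₂ (lookup (nodes t) v)
  ; rel = λ R a b → tRel R (proj₁ (lookup (nodes t) a)) (proj₁ (lookup (nodes t) b)) }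

data TΘ : Set where
  θ↓ θ↑ θ↓↓⁺ θ↑↑⁺ θ→ θ← θ⇉⁺ θ⇇⁺ θ≁ θ= : TΘ

tθ : ∀ {p} → TΘ → QF p TNav
tθ θ↓   = nav child vx vy
tθ θ↑   = nav child vy vx
tθ θ↓↓⁺ = and (nav desc vx vy) (neg (nav child vx vy))
tθ θ↑↑⁺ = and (nav desc vy vx) (neg (nav child vy vx))
tθ θ→   = nav next vx vy
tθ θ←   = nav next vy vx
tθ θ⇉⁺  = and (nav foll vx vy) (neg (nav next vx vy))
tθ θ⇇⁺  = and (nav foll vy vx) (neg (nav next vy vx))
tθ θ≁   = and (neg (eq vx vy))
          (and (neg (nav child vx vy)) (and (neg (nav child vy vx))
          (and (neg (nav desc vx vy))  (and (neg (nav desc vy vx))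
          (and (neg (nav next vx vy))  (and (neg (nav next vy vx))
          (and (neg (nav foll vx vy))  (neg (nav foll vy vx)))))))))
tθ θ=   = eq vx vy

data Setting : Set where
  words trees : Setting

Nav : Setting → Set
Nav words = WNav
Nav trees = TNav

Model : ℕ → Setting → Set
Model p words = Word p
Model p trees = Tree p

str : ∀ {p} S → Model p S → Structure p (Nav S)
str words w = wordStr w
str trees t = treeStr t

Θ : Setting → Set
Θ words = WΘ
Θ trees = TΘ

allΘ : (S : Setting) → List (Θ S)
allΘ words = θ= ∷ θ+1 ∷ θ-1 ∷ θ≪ ∷ θ≫ ∷ []
allΘ trees = θ↓ ∷ θ↑ ∷ θ↓↓⁺ ∷ θ↑↑⁺ ∷ θ→ ∷ θ← ∷ θ⇉⁺ ∷ θ⇇⁺ ∷ θ≁ ∷ θ= ∷ []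

θ-eq : (S : Setting) → Θ S
θ-eq words = θ=
θ-eq trees = θ=

θfml : ∀ {p} (S : Setting) → Θ S → QF p (Nav S)
θfml words θ = wθ θ
θfml trees θ = tθ θ

data Cmp : Set where
  ≤c ≥c : Cmp

cmpHolds : Cmp → ℕ → ℕ → Set
cmpHolds ≤c a b = a ≤ b
cmpHolds ≥c a b = b ≤ a

modℕ : ℕ → (l : ℕ) → 1 ≤ l → ℕ
modℕ n (suc l) _ = n % suc l

record NF (p : ℕ) (S : Setting) : Set where
  field
    χ    : QF p (Nav S)                 -- ∀x∀y χ
    n    : ℕ
    n≥1  : 1 ≤ n
    χs   : Fin n → QF p (Nav S)         -- ∀x∃y χ_i
    m    : ℕ
    m≥1  : 1 ≤ m
    cmp  : Fin m → Cmp
    k    : Fin m → ℕ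
    l    : Fin m → ℕ
    l≥1  : ∀ j → 1 ≤ l j
    k<l  : ∀ j → k j < l j
    ψ    : Fin m → QF p (Nav S)         -- ∀x ∃^{⋈_j k_j, l_j} y ψ_j

open NF public

_⊨_ : ∀ {p S} → Model p S → NF p S → Set
_⊨_ {S = S} M φ =
    (∀ a b → eval 𝔐 a b (χ φ) ≡ true)
  × (∀ i a → ∃ λ b → eval 𝔐 a b (χs φ i) ≡ true)
  × (∀ j a → cmpHolds (cmp φ j)
                      (modℕ (count (λ b → eval 𝔐 a b (ψ φ j))) (l φ j) (l≥1 φ j))
                      (k φ j))
  where 𝔐 = str S M

-- ᾱ : Θ → 1-types → {0,1} × Z_{l_1} × ... × Z_{l_m}
FullType : ∀ {p S} → NF p S → Set
FullType {p} {S} φ = Θ S → OneType p → Bool × (Fin (m φ) → ℕ)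

fullType : ∀ {p S} (φ : NF p S) (M : Model p S) → Fin (N (str S M)) → FullType φ
fullType {S = S} φ M v θ β =
  (not (W ≡ᵇ 0) , λ j → modℕ W (l φ j) (l≥1 φ j))
  where
  𝔐 = str S M
  W = count (λ w → eval 𝔐 v w (θfml S θ) ∧ (lab 𝔐 w ==ᵗ β))

NonZeroTuple : ∀ {m} → Bool × (Fin m → ℕ) → Set
NonZeroTuple (c , π) = c ≡ true ⊎ ∃ λ j → ¬ (π j ≡ 0)

Entails : ∀ {p} (S : Setting) → OneType p → OneType p → Θ S → QF p (Nav S) → Set
Entails {p} S α β θ χ' =
  (M : Model p S) (a b : Fin (N (str S M))) →
  lab (str S M) a ≡ α → lab (str S M) b ≡ β →
  eval (str S M) a b (θfml S θ) ≡ true →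
  eval (str S M) a b χ' ≡ true

sumΘβ : ∀ {p} (S : Setting) → (Θ S → OneType p → Bool) → (Θ S → OneType p → ℕ) → ℕ
sumΘβ {p} S sel f =
  sum (concatMap (λ θ → map (λ β → if sel θ β then f θ β else 0) (allTypes p)) (allΘ S))

-- φ-consistency; α is the 1-type with π₀(ᾱ(θ_=)(α)) = 1
Consistent : ∀ {p S} (φ : NF p S) → FullType φ → Set
Consistent {p} {S} φ ᾱ =
  ∀ (α : OneType p) → proj₁ (ᾱ (θ-eq S) α) ≡ true →
      (∀ θ β → NonZeroTuple (ᾱ θ β) → Entails S α β θ (χ φ))
    × (∀ i → Σ (Θ S) λ θ → Σ (OneType p) λ β →
               NonZeroTuple (ᾱ θ β) × Entails S α β θ (χs φ i))
    × (∀ j → (d : ∀ θ β → Dec (Entails S α β θ (ψ φ j))) →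
               cmpHolds (cmp φ j)
                 (modℕ (sumΘβ S (λ θ β → does (d θ β)) (λ θ β → proj₂ (ᾱ θ β) j))
                       (l φ j) (l≥1 φ j))
                 (k φ j))

module Submission where

-- Key fact: the order formulas Θ partition the pairs of elements, and the
-- order formula of (a, b) together with the 1-types of a, b fixes the truth
-- value of every quantifier-free formula at (a, b) (eval-by-θ).  It is proved
-- via the profile of a pair, the truth values of x = y and of the navigational
-- atoms between x and y: every profile occurring in a word (by induction on
-- positions) or a tree (by an exhaustive check of the profiles obeying the
-- laws of tree navigation) is the canonical profile of its order formula.
-- Hence α(x) ∧ β(y) ∧ θ(x,y) ⊨ ψ can be tested on one witness pair and is
-- decidable (entails?), and counting the y with ψ(v, y) amounts to summing the
-- counters of the full type of v over the cells (θ, β) selected by that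
-- entailment, also modulo l (modular-count).  The theorem then matches the
-- three conjuncts of φ against the three consistency conditions.

open import Defs
open import Data.Fin using (Fin)
open import Data.Nat using (ℕ)
open import Function.Bundles using (_⇔_)

open import Data.Bool using (Bool; true; false; _∧_; _∨_; not; if_then_else_; T; _xor_)
import Data.Bool.Properties as BoolP
open import Data.Bool.ListAction using (all) renaming (and to conj)
open import Data.Empty using (⊥; ⊥-elim)
open import Data.Fin using (toℕ; zero; suc)
open import Data.Fin.Properties using (toℕ-injective)
open import Data.List using (List; []; _∷_; _++_; map; concatMap; length; lookup; allFin)
open import Data.List.Membership.Propositional using (_∈_)
open import Data.List.Membership.Propositional.Properties using (∈-map⁺; ∈-++⁺ˡ; ∈-++⁺ʳ; ∈-allFin)
open import Data.List.Properties using (map-cong; map-∘; map-++; map-concatMap; concatMap-cong)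
open import Data.List.Relation.Unary.All using (All; []; _∷_)
import Data.List.Relation.Unary.All as All
open import Data.List.Relation.Unary.All.Properties using (all⁺)
open import Data.List.Relation.Unary.Any using (here; there)
open import Data.Nat using (zero; suc; _+_; _%_; _<_; _≤_; _≡ᵇ_; _<ᵇ_; _≤ᵇ_; NonZero)
open import Data.Nat.DivMod using (%-distribˡ-+; m%n%n≡m%n)
open import Data.Nat.ListAction using (sum)
open import Data.Nat.ListAction.Properties using (sum-++)
open import Data.Nat.Properties
  using (<ᵇ⇒<; <⇒<ᵇ; ≤⇒≤ᵇ; ≡ᵇ⇒≡; ≡⇒≡ᵇ; <-irrefl; <-asym; n<1+n; ≤-refl; +-identityʳ; +-commutativeSemigroup)
open import Algebra.Properties.CommutativeSemigroup +-commutativeSemigroup using (interchange)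
open import Data.Product using (Σ; ∃; _×_; _,_; proj₁; proj₂)
open import Data.Sum using (inj₁; inj₂)
open import Data.Unit using (tt)
open import Data.Vec using (Vec; []; _∷_)
open import Data.Vec.Properties using (≡-dec)
open import Function.Bundles using (mk⇔)
open import Relation.Binary.PropositionalEquality
open import Relation.Nullary using (Dec; yes; no; does; ¬_)
open import Relation.Nullary.Decidable using (dec-true)

fromTrue : ∀ {b} → b ≡ true → T b
fromTrue refl = tt

toTrue : ∀ {b} → T b → b ≡ true
toTrue {true} _ = refl

false≢true : ¬ false ≡ true
false≢true ()

∧-fst : ∀ {a b} → (a ∧ b) ≡ true → a ≡ true
∧-fst {true} _ = refl

∧-snd : ∀ {a b} → (a ∧ b) ≡ true → b ≡ true
∧-snd {true} b≡true = b≡true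

∧-intro : ∀ {a b} → a ≡ true → b ≡ true → (a ∧ b) ≡ true
∧-intro refl refl = refl

_implies_ : Bool → Bool → Bool
a implies b = not a ∨ b

nand : Bool → Bool → Bool
nand a b = not (a ∧ b)

_⇔ᵇ_ : Bool → Bool → Bool
a ⇔ᵇ b = not (a xor b)

impliesI : ∀ {a b} → (a ≡ true → b ≡ true) → (a implies b) ≡ true
impliesI {true}  a⇒b = a⇒b refl
impliesI {false} _   = refl

implies-elim : ∀ {a b} → (a implies b) ≡ true → a ≡ true → b ≡ true
implies-elim a⇒b refl = a⇒b

nandI : ∀ {a b} → (a ≡ true → b ≡ true → ⊥) → nand a b ≡ true
nandI {true}  {true}  excl with () ← excl refl refl
nandI {true}  {false} _ = refl
nandI {false}         _ = refl

⇔ᵇ-sound : ∀ a b → (a ⇔ᵇ b) ≡ true → a ≡ b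
⇔ᵇ-sound true  true  _ = refl
⇔ᵇ-sound false false _ = refl

conj-intro : ∀ {bs} → All (_≡ true) bs → conj bs ≡ true
conj-intro []           = refl
conj-intro (refl ∷ bs) = conj-intro bs

-- A Boolean test verified on a whole list holds at each member; this turns
-- the tabulated checks, which Agda evaluates, into lemmas.
all-sound : ∀ {A : Set} (f : A → Bool) {xs} → all f xs ≡ true → ∀ {x} → x ∈ xs → f x ≡ true
all-sound f {xs} checked x∈xs = toTrue (All.lookup (all⁺ f xs (fromTrue checked)) x∈xs)

≡ᵇ-sound : ∀ m n → (m ≡ᵇ n) ≡ true → m ≡ n
≡ᵇ-sound m n e = ≡ᵇ⇒≡ m n (fromTrue e)

<ᵇ-sound : ∀ m n → (m <ᵇ n) ≡ true → m < n
<ᵇ-sound m n e = <ᵇ⇒< m n (fromTrue e)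

≡ᵇ-refl : ∀ n → (n ≡ᵇ n) ≡ true
≡ᵇ-refl n = toTrue (≡⇒≡ᵇ n n refl)

≡ᵇ-sym : ∀ m n → (m ≡ᵇ n) ≡ (n ≡ᵇ m)
≡ᵇ-sym zero    zero    = refl
≡ᵇ-sym zero    (suc n) = refl
≡ᵇ-sym (suc m) zero    = refl
≡ᵇ-sym (suc m) (suc n) = ≡ᵇ-sym m n

≤ᵇ-refl : ∀ i → (i ≤ᵇ i) ≡ true
≤ᵇ-refl i = toTrue (≤⇒≤ᵇ (≤-refl {i}))

suc-≢ᵇ : ∀ i → (suc i ≡ᵇ i) ≡ true → ⊥
suc-≢ᵇ i e = <-irrefl (sym (≡ᵇ-sound (suc i) i e)) (n<1+n i)

<ᵇ-irrefl : ∀ i → (i <ᵇ i) ≡ true → ⊥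
<ᵇ-irrefl i i<i = <-irrefl refl (<ᵇ-sound i i i<i)

<ᵇ-asym : ∀ i j → (i <ᵇ j) ≡ true → (j <ᵇ i) ≡ true → ⊥
<ᵇ-asym i j i<j j<i = <-asym (<ᵇ-sound i j i<j) (<ᵇ-sound j i j<i)

finEq-sound : ∀ {N} (a b : Fin N) → finEq a b ≡ true → a ≡ b
finEq-sound a b e = toℕ-injective (≡ᵇ-sound (toℕ a) (toℕ b) e)

finEq-refl : ∀ {N} (a : Fin N) → finEq a a ≡ true
finEq-refl a = ≡ᵇ-refl (toℕ a)

finEq-sym : ∀ {N} (a b : Fin N) → finEq b a ≡ finEq a b
finEq-sym a b = ≡ᵇ-sym (toℕ b) (toℕ a)

ind : Bool → ℕ
ind b = if b then 1 else 0

sum-cong : ∀ {A : Set} {f g : A → ℕ} → (∀ x → f x ≡ g x) → ∀ xs → sum (map f xs) ≡ sum (map g xs)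
sum-cong f≗g xs = cong sum (map-cong f≗g xs)

sum-if : ∀ {A : Set} (s : Bool) (f : A → ℕ) xs →
         sum (map (λ x → if s then f x else 0) xs) ≡ (if s then sum (map f xs) else 0)
sum-if true  f xs       = refl
sum-if false f []       = refl
sum-if false f (x ∷ xs) = sum-if false f xs

sum-+ : ∀ {A : Set} (f g : A → ℕ) xs →
        sum (map (λ x → f x + g x) xs) ≡ sum (map f xs) + sum (map g xs)
sum-+ f g []       = refl
sum-+ f g (x ∷ xs) = trans (cong (f x + g x +_) (sum-+ f g xs)) (interchange (f x) (g x) _ _)

sum-swap : ∀ {A B : Set} (f : A → B → ℕ) xs ys →
  sum (map (λ x → sum (map (f x) ys)) xs) ≡ sum (map (λ y → sum (map (λ x → f x y) xs)) ys)
sum-swap f []       ys = sym (sum-if false (λ _ → 0) ys)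
sum-swap f (x ∷ xs) ys =
  trans (cong (sum (map (f x) ys) +_) (sum-swap f xs ys))
        (sym (sum-+ (f x) (λ y → sum (map (λ x' → f x' y) xs)) ys))

sum-concatMap : ∀ {A : Set} (f : A → List ℕ) xs → sum (concatMap f xs) ≡ sum (map (λ x → sum (f x)) xs)
sum-concatMap f []       = refl
sum-concatMap f (x ∷ xs) = trans (sum-++ (f x) (concatMap f xs)) (cong (sum (f x) +_) (sum-concatMap f xs))

sum-mod : ∀ d .{{_ : NonZero d}} xs → sum (map (_% d) xs) % d ≡ sum xs % d
sum-mod d []       = refl
sum-mod d (x ∷ xs) = begin
  (x % d + sum (map (_% d) xs)) % d           ≡⟨ %-distribˡ-+ (x % d) _ d ⟩
  (x % d % d + sum (map (_% d) xs) % d) % d   ≡⟨ cong₂ (λ m n → (m + n) % d) (m%n%n≡m%n x d) (sum-mod d xs) ⟩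
  (x % d + sum xs % d) % d                    ≡⟨ %-distribˡ-+ x (sum xs) d ⟨
  (x + sum xs) % d                            ∎
  where open ≡-Reasoning

count-witness : ∀ {N} (f : Fin N → Bool) → ¬ count f ≡ 0 → ∃ λ w → f w ≡ true
count-witness {N} f = witness (allFin N)
  where
  witness : ∀ ws → ¬ sum (map (λ w → ind (f w)) ws) ≡ 0 → ∃ λ w → f w ≡ true
  witness []       nonzero = ⊥-elim (nonzero refl)
  witness (w ∷ ws) nonzero with f w in fw
  ... | true  = w , fw
  ... | false = witness ws nonzero

count-positive : ∀ {N} (f : Fin N → Bool) w → f w ≡ true → ¬ count f ≡ 0
count-positive {N} f w fw = positive (∈-allFin w)
  where
  positive : ∀ {ws} → w ∈ ws → ¬ sum (map (λ w → ind (f w)) ws) ≡ 0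
  positive {w ∷ _}  (here refl) rewrite fw = λ ()
  positive {w' ∷ _} (there w∈)  with f w'
  ... | true  = λ ()
  ... | false = positive w∈

count-cong : ∀ {N} {f g : Fin N → Bool} → (∀ w → f w ≡ g w) → count f ≡ count g
count-cong {N} f≗g = sum-cong (λ w → cong ind (f≗g w)) (allFin N)

==ᵗ-refl : ∀ {p} (α : OneType p) → (α ==ᵗ α) ≡ true
==ᵗ-refl α = dec-true (≡-dec BoolP._≟_ α α) refl

==ᵗ-sound : ∀ {p} {α β : OneType p} → (α ==ᵗ β) ≡ true → α ≡ β
==ᵗ-sound {α = α} {β} e with ≡-dec BoolP._≟_ α β
==ᵗ-sound _  | yes α≡β = α≡β
==ᵗ-sound () | no _

∈-allTypes : ∀ {p} (α : OneType p) → α ∈ allTypes p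
∈-allTypes []          = here refl
∈-allTypes (true  ∷ α) = ∈-++⁺ˡ (∈-map⁺ (true ∷_) (∈-allTypes α))
∈-allTypes (false ∷ α) = ∈-++⁺ʳ _ (∈-map⁺ (false ∷_) (∈-allTypes α))

select-type : ∀ {p} (α : OneType p) (g : OneType p → ℕ) →
              sum (map (λ β → if α ==ᵗ β then g β else 0) (allTypes p)) ≡ g α
select-type []      g = +-identityʳ (g [])
select-type {suc p} (c ∷ α) g = begin
    sum (map G (map (true ∷_) types ++ map (false ∷_) types))
  ≡⟨ cong sum (map-++ G (map (true ∷_) types) _) ⟩
    sum (map G (map (true ∷_) types) ++ map G (map (false ∷_) types))
  ≡⟨ sum-++ (map G (map (true ∷_) types)) _ ⟩
    sum (map G (map (true ∷_) types)) + sum (map G (map (false ∷_) types))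
  ≡⟨ cong₂ _+_ (cong sum (map-∘ types)) (cong sum (map-∘ types)) ⟨
    sum (map (λ β → G (true ∷ β)) types) + sum (map (λ β → G (false ∷ β)) types)
  ≡⟨ halves c ⟩
    g (c ∷ α)
  ∎
  where
  open ≡-Reasoning
  types : List (OneType p)
  types = allTypes p
  G : OneType (suc p) → ℕ
  G β = if (c ∷ α) ==ᵗ β then g β else 0
  -- the half of the enumeration with the wrong first bit contributes nothing
  halves : ∀ c → sum (map (λ β → if (c ∷ α) ==ᵗ (true ∷ β) then g (true ∷ β) else 0) types)
               + sum (map (λ β → if (c ∷ α) ==ᵗ (false ∷ β) then g (false ∷ β) else 0) types)
               ≡ g (c ∷ α)
  halves true  = trans (cong₂ _+_ (select-type α (λ β → g (true ∷ β))) (sum-if false (λ _ → 0) types))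
                       (+-identityʳ _)
  halves false = cong₂ _+_ (sum-if false (λ _ → 0) types) (select-type α (λ β → g (false ∷ β)))

at : ∀ {A : Set} → A → A → Var → A
at a b vx = a
at a b vy = b

evalAt : ∀ {p} {Nav : Set} → OneType p → OneType p →
         (Nav → Var → Var → Bool) → (Var → Var → Bool) → QF p Nav → Bool
evalAt α β navs eqs (un P v)    = lookupV (at α β v) P
evalAt α β navs eqs (nav R u v) = navs R u v
evalAt α β navs eqs (eq u v)    = eqs u v
evalAt α β navs eqs tt          = true
evalAt α β navs eqs (neg ψ)     = not (evalAt α β navs eqs ψ)
evalAt α β navs eqs (and ψ ψ')  = evalAt α β navs eqs ψ ∧ evalAt α β navs eqs ψ'
evalAt α β navs eqs (or ψ ψ')   = evalAt α β navs eqs ψ ∨ evalAt α β navs eqs ψ'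

eval-local : ∀ {p} {Nav : Set} (M : Structure p Nav) a b
  (navs : Nav → Var → Var → Bool) (eqs : Var → Var → Bool) →
  (∀ R u v → rel M R (at a b u) (at a b v) ≡ navs R u v) →
  (∀ u v → finEq (at a b u) (at a b v) ≡ eqs u v) →
  ∀ ψ → eval M a b ψ ≡ evalAt (lab M a) (lab M b) navs eqs ψ
eval-local M a b navs eqs hn he = go
  where
  go : ∀ ψ → eval M a b ψ ≡ evalAt (lab M a) (lab M b) navs eqs ψ
  go (un P vx)     = refl
  go (un P vy)     = refl
  go (nav R vx vx) = hn R vx vx
  go (nav R vx vy) = hn R vx vy
  go (nav R vy vx) = hn R vy vx
  go (nav R vy vy) = hn R vy vy
  go (eq vx vx)    = he vx vx
  go (eq vx vy)    = he vx vy
  go (eq vy vx)    = he vy vx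
  go (eq vy vy)    = he vy vy
  go tt            = refl
  go (neg ψ)       = cong not (go ψ)
  go (and ψ ψ')    = cong₂ _∧_ (go ψ) (go ψ')
  go (or ψ ψ')     = cong₂ _∨_ (go ψ) (go ψ')

-- Profiles: the truth values of x = y and of the navigational atoms R(x,y),
-- R(y,x); the atoms R(x,x), R(y,y), x = x are the same in every word (tree).

width : Setting → ℕ
width words = 5
width trees = 9

onVars : Bool → Bool → Bool → Var → Var → Bool
onVars d xy yx vx vx = d
onVars d xy yx vx vy = xy
onVars d xy yx vy vx = yx
onVars d xy yx vy vy = d

treeBits : Vec Bool 9 → TNav → Bool × Bool
treeBits (_ ∷ cxy ∷ cyx ∷ _   ∷ _   ∷ _   ∷ _   ∷ _   ∷ _   ∷ []) child = cxy , cyx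
treeBits (_ ∷ _   ∷ _   ∷ dxy ∷ dyx ∷ _   ∷ _   ∷ _   ∷ _   ∷ []) desc  = dxy , dyx
treeBits (_ ∷ _   ∷ _   ∷ _   ∷ _   ∷ nxy ∷ nyx ∷ _   ∷ _   ∷ []) next  = nxy , nyx
treeBits (_ ∷ _   ∷ _   ∷ _   ∷ _   ∷ _   ∷ _   ∷ fxy ∷ fyx ∷ []) foll  = fxy , fyx

navOf : ∀ S → Vec Bool (width S) → Nav S → Var → Var → Bool
navOf words (_ ∷ lxy ∷ lyx ∷ _   ∷ _   ∷ []) leq  = onVars true  lxy lyx
navOf words (_ ∷ _   ∷ _   ∷ sxy ∷ syx ∷ []) succ = onVars false sxy syx
navOf trees bs R = onVars false (proj₁ (treeBits bs R)) (proj₂ (treeBits bs R))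

eqOf : ∀ S → Vec Bool (width S) → Var → Var → Bool
eqOf words (e ∷ _) = onVars true e e
eqOf trees (e ∷ _) = onVars true e e

wordProfile : ℕ → ℕ → Vec Bool 5
wordProfile i j = (i ≡ᵇ j) ∷ (i ≤ᵇ j) ∷ (j ≤ᵇ i) ∷ (suc i ≡ᵇ j) ∷ (suc j ≡ᵇ i) ∷ []

canonW : WΘ → Vec Bool 5
canonW θ=  = true  ∷ true  ∷ true  ∷ false ∷ false ∷ []
canonW θ+1 = false ∷ true  ∷ false ∷ true  ∷ false ∷ []
canonW θ-1 = false ∷ false ∷ true  ∷ false ∷ true  ∷ []
canonW θ≪  = false ∷ true  ∷ false ∷ false ∷ false ∷ []
canonW θ≫  = false ∷ false ∷ true  ∷ false ∷ false ∷ []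

classifyW : Vec Bool 5 → WΘ
classifyW (e ∷ lxy ∷ _ ∷ sxy ∷ syx ∷ []) =
  if e then θ= else if sxy then θ+1 else if syx then θ-1 else if lxy then θ≪ else θ≫

≤ᵇ-suc : ∀ i j → (suc i ≤ᵇ suc j) ≡ (i ≤ᵇ j)
≤ᵇ-suc zero    j = refl
≤ᵇ-suc (suc i) j = refl

wordProfile-suc : ∀ i j → wordProfile (suc i) (suc j) ≡ wordProfile i j
wordProfile-suc i j rewrite ≤ᵇ-suc i j | ≤ᵇ-suc j i = refl

-- ... so it suffices to inspect pairs with one position 0.
wordProfile-canonical : ∀ i j → wordProfile i j ≡ canonW (classifyW (wordProfile i j))
wordProfile-canonical zero          zero          = refl
wordProfile-canonical zero          (suc zero)    = refl
wordProfile-canonical zero          (suc (suc j)) = refl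
wordProfile-canonical (suc zero)    zero          = refl
wordProfile-canonical (suc (suc i)) zero          = refl
wordProfile-canonical (suc i)       (suc j) =
  subst (λ bs → bs ≡ canonW (classifyW bs)) (sym (wordProfile-suc i j)) (wordProfile-canonical i j)

sib-length : ∀ R x y → sib R x y ≡ true → length x ≡ length y
sib-length R (a ∷ [])       (b ∷ [])       _ = refl
sib-length R (a ∷ a' ∷ as) (b ∷ b' ∷ bs) e =
  cong suc (sib-length R (a' ∷ as) (b' ∷ bs) (∧-snd {a ≡ᵇ b} e))

sib-irrefl : ∀ R → (∀ i → R i i ≡ true → ⊥) → ∀ x → sib R x x ≡ true → ⊥
sib-irrefl R irr (a ∷ [])       e = irr a e
sib-irrefl R irr (a ∷ a' ∷ as) e = sib-irrefl R irr (a' ∷ as) (∧-snd {a ≡ᵇ a} e)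

sib-mono : ∀ R R' → (∀ i j → R i j ≡ true → R' i j ≡ true) →
           ∀ x y → sib R x y ≡ true → sib R' x y ≡ true
sib-mono R R' R⇒R' (a ∷ [])       (b ∷ [])       e = R⇒R' a b e
sib-mono R R' R⇒R' (a ∷ a' ∷ as) (b ∷ b' ∷ bs) e =
  ∧-intro (∧-fst {a ≡ᵇ b} e) (sib-mono R R' R⇒R' (a' ∷ as) (b' ∷ bs) (∧-snd {a ≡ᵇ b} e))

sib-asym : ∀ R → (∀ i j → R i j ≡ true → R j i ≡ true → ⊥) →
           ∀ x y → sib R x y ≡ true → sib R y x ≡ true → ⊥
sib-asym R asym (a ∷ [])       (b ∷ [])       e e' = asym a b e e'
sib-asym R asym (a ∷ a' ∷ as) (b ∷ b' ∷ bs) e e' =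
  sib-asym R asym (a' ∷ as) (b' ∷ bs) (∧-snd {a ≡ᵇ b} e) (∧-snd {b ≡ᵇ a} e')

desc-length : ∀ x y → tRel desc x y ≡ true → length x < length y
desc-length x y e = <ᵇ-sound (length x) (length y) (∧-snd {isPrefix x y} e)

tRel-irrefl : ∀ R x → tRel R x x ≡ true → ⊥
tRel-irrefl child x e = <-irrefl (≡ᵇ-sound (length x) _ (∧-snd {isPrefix x x} e)) (n<1+n (length x))
tRel-irrefl desc  x e = <-irrefl refl (desc-length x x e)
tRel-irrefl next  x e = sib-irrefl _ suc-≢ᵇ x e
tRel-irrefl foll  x e = sib-irrefl _ <ᵇ-irrefl x e

irrefl-at : ∀ R {x y} → x ≡ y → tRel R x y ≡ true → ⊥
irrefl-at R {x} refl = tRel-irrefl R x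

child⇒desc : ∀ x y → tRel child x y ≡ true → tRel desc x y ≡ true
child⇒desc x y e = ∧-intro (∧-fst {isPrefix x y} e)
  (toTrue (<⇒<ᵇ (subst (length x <_) (sym ly≡1+lx) (n<1+n (length x)))))
  where
  ly≡1+lx : length y ≡ suc (length x)
  ly≡1+lx = ≡ᵇ-sound (length y) _ (∧-snd {isPrefix x y} e)

next⇒foll : ∀ x y → tRel next x y ≡ true → tRel foll x y ≡ true
next⇒foll = sib-mono _ _ (λ i j e → toTrue (<⇒<ᵇ (subst (i <_) (≡ᵇ-sound (suc i) j e) (n<1+n i))))

desc-asym : ∀ x y → tRel desc x y ≡ true → tRel desc y x ≡ true → ⊥
desc-asym x y e e' = <-asym (desc-length x y e) (desc-length y x e')

-- Siblings have equal depth, descendants are deeper.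
desc-excludes-foll : ∀ x y → tRel desc x y ≡ true → tRel foll x y ≡ true → ⊥
desc-excludes-foll x y d f = <-irrefl (sib-length _ x y f) (desc-length x y d)

desc-excludes-foll⁻ : ∀ x y → tRel desc x y ≡ true → tRel foll y x ≡ true → ⊥
desc-excludes-foll⁻ x y d f = <-irrefl (sym (sib-length _ y x f)) (desc-length x y d)

foll-asym : ∀ x y → tRel foll x y ≡ true → tRel foll y x ≡ true → ⊥
foll-asym = sib-asym _ <ᵇ-asym

treeProfile : Address → Address → Bool → Vec Bool 9
treeProfile x y e = e ∷ tRel child x y ∷ tRel child y x ∷ tRel desc x y ∷ tRel desc y x ∷
                    tRel next x y ∷ tRel next y x ∷ tRel foll x y ∷ tRel foll y x ∷ []

treeLaws : Vec Bool 9 → List Bool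
treeLaws (e ∷ cxy ∷ cyx ∷ dxy ∷ dyx ∷ nxy ∷ nyx ∷ fxy ∷ fyx ∷ []) =
  nand e cxy ∷ nand e cyx ∷ nand e dxy ∷ nand e dyx ∷
  nand e nxy ∷ nand e nyx ∷ nand e fxy ∷ nand e fyx ∷
  (cxy implies dxy) ∷ (cyx implies dyx) ∷ (nxy implies fxy) ∷ (nyx implies fyx) ∷
  nand dxy dyx ∷ nand dxy fxy ∷ nand dxy fyx ∷ nand dyx fxy ∷ nand dyx fyx ∷ nand fxy fyx ∷ []

treeProfile-lawful : ∀ x y e → (e ≡ true → x ≡ y) → All (_≡ true) (treeLaws (treeProfile x y e))
treeProfile-lawful x y e x≡y =
  nandI (λ et → irrefl-at child (x≡y et)) ∷ nandI (λ et → irrefl-at child (sym (x≡y et))) ∷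
  nandI (λ et → irrefl-at desc  (x≡y et)) ∷ nandI (λ et → irrefl-at desc  (sym (x≡y et))) ∷
  nandI (λ et → irrefl-at next  (x≡y et)) ∷ nandI (λ et → irrefl-at next  (sym (x≡y et))) ∷
  nandI (λ et → irrefl-at foll  (x≡y et)) ∷ nandI (λ et → irrefl-at foll  (sym (x≡y et))) ∷
  impliesI (child⇒desc x y) ∷ impliesI (child⇒desc y x) ∷
  impliesI (next⇒foll x y) ∷ impliesI (next⇒foll y x) ∷
  nandI (desc-asym x y) ∷ nandI (desc-excludes-foll x y) ∷ nandI (desc-excludes-foll⁻ x y) ∷
  nandI (desc-excludes-foll⁻ y x) ∷ nandI (desc-excludes-foll y x) ∷ nandI (foll-asym x y) ∷ []

canonT : TΘ → Vec Bool 9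
canonT θ↓   = false ∷ true  ∷ false ∷ true  ∷ false ∷ false ∷ false ∷ false ∷ false ∷ []
canonT θ↑   = false ∷ false ∷ true  ∷ false ∷ true  ∷ false ∷ false ∷ false ∷ false ∷ []
canonT θ↓↓⁺ = false ∷ false ∷ false ∷ true  ∷ false ∷ false ∷ false ∷ false ∷ false ∷ []
canonT θ↑↑⁺ = false ∷ false ∷ false ∷ false ∷ true  ∷ false ∷ false ∷ false ∷ false ∷ []
canonT θ→   = false ∷ false ∷ false ∷ false ∷ false ∷ true  ∷ false ∷ true  ∷ false ∷ []
canonT θ←   = false ∷ false ∷ false ∷ false ∷ false ∷ false ∷ true  ∷ false ∷ true  ∷ []
canonT θ⇉⁺  = false ∷ false ∷ false ∷ false ∷ false ∷ false ∷ false ∷ true  ∷ false ∷ []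
canonT θ⇇⁺  = false ∷ false ∷ false ∷ false ∷ false ∷ false ∷ false ∷ false ∷ true  ∷ []
canonT θ≁   = false ∷ false ∷ false ∷ false ∷ false ∷ false ∷ false ∷ false ∷ false ∷ []
canonT θ=   = true  ∷ false ∷ false ∷ false ∷ false ∷ false ∷ false ∷ false ∷ false ∷ []

classifyT : Vec Bool 9 → TΘ
classifyT (e ∷ cxy ∷ cyx ∷ dxy ∷ dyx ∷ nxy ∷ nyx ∷ fxy ∷ fyx ∷ []) =
  if e then θ= else if cxy then θ↓ else if cyx then θ↑ else if dxy then θ↓↓⁺ else if dyx then θ↑↑⁺
  else if nxy then θ→ else if nyx then θ← else if fxy then θ⇉⁺ else if fyx then θ⇇⁺ else θ≁

lawful-canonical-check :
  all (λ bs → conj (treeLaws bs) implies (bs ==ᵗ canonT (classifyT bs))) (allTypes 9) ≡ true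
lawful-canonical-check = refl

treeProfile-canonical : ∀ x y e → (e ≡ true → x ≡ y) →
  treeProfile x y e ≡ canonT (classifyT (treeProfile x y e))
treeProfile-canonical x y e x≡y = ==ᵗ-sound (implies-elim
  (all-sound (λ bs → conj (treeLaws bs) implies (bs ==ᵗ canonT (classifyT bs)))
             lawful-canonical-check (∈-allTypes (treeProfile x y e)))
  (conj-intro (treeProfile-lawful x y e x≡y)))

canon : ∀ S → Θ S → Vec Bool (width S)
canon words = canonW
canon trees = canonT

classify : ∀ S → Vec Bool (width S) → Θ S
classify words = classifyW
classify trees = classifyT

classify-canon : ∀ S θ → classify S (canon S θ) ≡ θ
classify-canon words θ=  = refl
classify-canon words θ+1 = refl
classify-canon words θ-1 = refl
classify-canon words θ≪  = refl
classify-canon words θ≫  = refl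
classify-canon trees θ↓   = refl
classify-canon trees θ↑   = refl
classify-canon trees θ↓↓⁺ = refl
classify-canon trees θ↑↑⁺ = refl
classify-canon trees θ→   = refl
classify-canon trees θ←   = refl
classify-canon trees θ⇉⁺  = refl
classify-canon trees θ⇇⁺  = refl
classify-canon trees θ≁   = refl
classify-canon trees θ=   = refl

∈-allΘ : ∀ S (θ : Θ S) → θ ∈ allΘ S
∈-allΘ words θ=  = here refl
∈-allΘ words θ+1 = there (here refl)
∈-allΘ words θ-1 = there (there (here refl))
∈-allΘ words θ≪  = there (there (there (here refl)))
∈-allΘ words θ≫  = there (there (there (there (here refl))))
∈-allΘ trees θ↓   = here refl
∈-allΘ trees θ↑   = there (here refl)
∈-allΘ trees θ↓↓⁺ = there (there (here refl))
∈-allΘ trees θ↑↑⁺ = there (there (there (here refl)))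
∈-allΘ trees θ→   = there (there (there (there (here refl))))
∈-allΘ trees θ←   = there (there (there (there (there (here refl)))))
∈-allΘ trees θ⇉⁺  = there (there (there (there (there (there (here refl))))))
∈-allΘ trees θ⇇⁺  = there (there (there (there (there (there (there (here refl)))))))
∈-allΘ trees θ≁   = there (there (there (there (there (there (there (there (here refl))))))))
∈-allΘ trees θ=   = there (there (there (there (there (there (there (there (there (here refl)))))))))

evalθ : ∀ {p} S → OneType p → OneType p → Θ S → QF p (Nav S) → Bool
evalθ S α β θ = evalAt α β (navOf S (canon S θ)) (eqOf S (canon S θ))

θ-table-check : ∀ {p} S (α β : OneType p) →
  all (λ θ₀ → all (λ θ → evalθ S α β θ₀ (θfml S θ) ⇔ᵇ (canon S θ₀ ==ᵗ canon S θ)) (allΘ S)) (allΘ S) ≡ true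
θ-table-check words α β = refl
θ-table-check trees α β = refl

θ-table : ∀ {p} S (α β : OneType p) θ₀ θ → evalθ S α β θ₀ (θfml S θ) ≡ (canon S θ₀ ==ᵗ canon S θ)
θ-table S α β θ₀ θ = ⇔ᵇ-sound _ _
  (all-sound _ (all-sound _ (θ-table-check S α β) (∈-allΘ S θ₀)) (∈-allΘ S θ))

θ-self : ∀ {p} S (α β : OneType p) θ → evalθ S α β θ (θfml S θ) ≡ true
θ-self S α β θ = trans (θ-table S α β θ θ) (==ᵗ-refl (canon S θ))

θ-exclusive : ∀ {p} S (α β : OneType p) θ₀ θ → evalθ S α β θ₀ (θfml S θ) ≡ true → θ₀ ≡ θ
θ-exclusive S α β θ₀ θ e = begin
  θ₀                        ≡⟨ classify-canon S θ₀ ⟨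
  classify S (canon S θ₀)   ≡⟨ cong (classify S) (==ᵗ-sound (trans (sym (θ-table S α β θ₀ θ)) e)) ⟩
  classify S (canon S θ)    ≡⟨ classify-canon S θ ⟩
  θ                         ∎
  where open ≡-Reasoning

select-Θ : ∀ {p} S (α β : OneType p) θ₀ (g : Θ S → ℕ) →
  sum (map (λ θ → if evalθ S α β θ₀ (θfml S θ) then g θ else 0) (allΘ S)) ≡ g θ₀
select-Θ words α β θ=  g = +-identityʳ (g θ=)
select-Θ words α β θ+1 g = +-identityʳ (g θ+1)
select-Θ words α β θ-1 g = +-identityʳ (g θ-1)
select-Θ words α β θ≪  g = +-identityʳ (g θ≪)
select-Θ words α β θ≫  g = +-identityʳ (g θ≫)
select-Θ trees α β θ↓   g = +-identityʳ (g θ↓)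
select-Θ trees α β θ↑   g = +-identityʳ (g θ↑)
select-Θ trees α β θ↓↓⁺ g = +-identityʳ (g θ↓↓⁺)
select-Θ trees α β θ↑↑⁺ g = +-identityʳ (g θ↑↑⁺)
select-Θ trees α β θ→   g = +-identityʳ (g θ→)
select-Θ trees α β θ←   g = +-identityʳ (g θ←)
select-Θ trees α β θ⇉⁺  g = +-identityʳ (g θ⇉⁺)
select-Θ trees α β θ⇇⁺  g = +-identityʳ (g θ⇇⁺)
select-Θ trees α β θ≁   g = +-identityʳ (g θ≁)
select-Θ trees α β θ=   g = +-identityʳ (g θ=)

address : ∀ {p} (t : Tree p) → Fin (N (treeStr t)) → Address
address t v = proj₁ (lookup (nodes t) v)

profile : ∀ {p} S (M : Model p S) → Fin (N (str S M)) → Fin (N (str S M)) → Vec Bool (width S)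
profile words w a b = wordProfile (toℕ a) (toℕ b)
profile trees t a b = treeProfile (address t a) (address t b) (finEq a b)

profile-nav : ∀ {p} S (M : Model p S) a b R u v →
  rel (str S M) R (at a b u) (at a b v) ≡ navOf S (profile S M a b) R u v
profile-nav words w a b leq  vx vx = ≤ᵇ-refl (toℕ a)
profile-nav words w a b leq  vx vy = refl
profile-nav words w a b leq  vy vx = refl
profile-nav words w a b leq  vy vy = ≤ᵇ-refl (toℕ b)
profile-nav words w a b succ vx vx = BoolP.¬-not (suc-≢ᵇ (toℕ a))
profile-nav words w a b succ vx vy = refl
profile-nav words w a b succ vy vx = refl
profile-nav words w a b succ vy vy = BoolP.¬-not (suc-≢ᵇ (toℕ b))
profile-nav trees t a b R     vx vx = BoolP.¬-not (tRel-irrefl R (address t a))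
profile-nav trees t a b R     vy vy = BoolP.¬-not (tRel-irrefl R (address t b))
profile-nav trees t a b child vx vy = refl
profile-nav trees t a b child vy vx = refl
profile-nav trees t a b desc  vx vy = refl
profile-nav trees t a b desc  vy vx = refl
profile-nav trees t a b next  vx vy = refl
profile-nav trees t a b next  vy vx = refl
profile-nav trees t a b foll  vx vy = refl
profile-nav trees t a b foll  vy vx = refl

profile-eq : ∀ {p} S (M : Model p S) a b u v →
  finEq (at a b u) (at a b v) ≡ eqOf S (profile S M a b) u v
profile-eq words w a b vx vx = finEq-refl a
profile-eq words w a b vx vy = refl
profile-eq words w a b vy vx = finEq-sym a b
profile-eq words w a b vy vy = finEq-refl b
profile-eq trees t a b vx vx = finEq-refl a
profile-eq trees t a b vx vy = refl
profile-eq trees t a b vy vx = finEq-sym a b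
profile-eq trees t a b vy vy = finEq-refl b

θ-of : ∀ {p} S (M : Model p S) → Fin (N (str S M)) → Fin (N (str S M)) → Θ S
θ-of S M a b = classify S (profile S M a b)

profile-canonical : ∀ {p} S (M : Model p S) a b → profile S M a b ≡ canon S (θ-of S M a b)
profile-canonical words w a b = wordProfile-canonical (toℕ a) (toℕ b)
profile-canonical trees t a b = treeProfile-canonical (address t a) (address t b) (finEq a b)
  (λ e → cong (address t) (finEq-sound a b e))

eval-by-θ : ∀ {p} S (M : Model p S) a b ψ →
  eval (str S M) a b ψ ≡ evalθ S (lab (str S M) a) (lab (str S M) b) (θ-of S M a b) ψ
eval-by-θ S M a b = eval-local (str S M) a b _ _
  (λ R u v → trans (profile-nav S M a b R u v) (cong (λ bs → navOf S bs R u v) (profile-canonical S M a b)))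
  (λ u v → trans (profile-eq S M a b u v) (cong (λ bs → eqOf S bs u v) (profile-canonical S M a b)))

θ-of-holds : ∀ {p} S (M : Model p S) a b → eval (str S M) a b (θfml S (θ-of S M a b)) ≡ true
θ-of-holds S M a b = trans (eval-by-θ S M a b (θfml S (θ-of S M a b))) (θ-self S _ _ (θ-of S M a b))

θ-of-unique : ∀ {p} S (M : Model p S) a b θ → eval (str S M) a b (θfml S θ) ≡ true → θ-of S M a b ≡ θ
θ-of-unique S M a b θ e = θ-exclusive S _ _ (θ-of S M a b) θ (trans (sym (eval-by-θ S M a b (θfml S θ))) e)

eval-θ-eq : ∀ {p} S (M : Model p S) a b → eval (str S M) a b (θfml S (θ-eq S)) ≡ finEq a b
eval-θ-eq words w a b = refl
eval-θ-eq trees t a b = refl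

entails-from-instance : ∀ {p} S (M : Model p S) a b θ ψ →
  eval (str S M) a b (θfml S θ) ≡ true → eval (str S M) a b ψ ≡ true →
  Entails S (lab (str S M) a) (lab (str S M) b) θ ψ
entails-from-instance S M a b θ ψ θab ψab M' a' b' la' lb' θa'b' = begin
  eval (str S M') a' b' ψ                                   ≡⟨ eval-by-θ S M' a' b' ψ ⟩
  evalθ S (lab (str S M') a') (lab (str S M') b') θ' ψ       ≡⟨ cong₂ (λ α β → evalθ S α β θ' ψ) la' lb' ⟩
  evalθ S (lab (str S M) a) (lab (str S M) b) θ' ψ           ≡⟨ cong (λ θ'' → evalθ S _ _ θ'' ψ) same-order-type ⟩
  evalθ S (lab (str S M) a) (lab (str S M) b) (θ-of S M a b) ψ ≡⟨ eval-by-θ S M a b ψ ⟨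
  eval (str S M) a b ψ                                      ≡⟨ ψab ⟩
  true                                                      ∎
  where
  open ≡-Reasoning
  θ' : Θ S
  θ' = θ-of S M' a' b'
  same-order-type : θ' ≡ θ-of S M a b
  same-order-type = trans (θ-of-unique S M' a' b' θ θa'b') (sym (θ-of-unique S M a b θ θab))

Realization : ∀ {p} S → OneType p → OneType p → Θ S → Set
Realization {p} S α β θ = Σ (Model p S) λ M → Σ (Fin (N (str S M))) λ a → Σ (Fin (N (str S M))) λ b →
  lab (str S M) a ≡ α × lab (str S M) b ≡ β × eval (str S M) a b (θfml S θ) ≡ true

realizable-θ-eq : ∀ {p} S (α β : OneType p) → Dec (Realization S α β (θ-eq S))
realizable-θ-eq S α β with ≡-dec BoolP._≟_ α β
... | yes refl = yes (single S)
  where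
  single : ∀ S → Realization S α α (θ-eq S)
  single words = (α ∷ []) , zero , zero , refl , refl , refl
  single trees = node α [] , zero , zero , refl , refl , refl
... | no α≢β = no λ (M , a , b , la , lb , θab) →
  let a≡b = finEq-sound a b (trans (sym (eval-θ-eq S M a b)) θab)
  in α≢β (trans (sym la) (trans (cong (lab (str S M)) a≡b) lb))

realizable? : ∀ {p} S (α β : OneType p) θ → Dec (Realization S α β θ)
realizable? words α β θ=  = realizable-θ-eq words α β
realizable? words α β θ+1 = yes ((α ∷ β ∷ []) , zero , suc zero , refl , refl , refl)
realizable? words α β θ-1 = yes ((β ∷ α ∷ []) , suc zero , zero , refl , refl , refl)
realizable? words α β θ≪  = yes ((α ∷ α ∷ β ∷ []) , zero , suc (suc zero) , refl , refl , refl)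
realizable? words α β θ≫  = yes ((β ∷ β ∷ α ∷ []) , suc (suc zero) , zero , refl , refl , refl)
realizable? trees α β θ=  = realizable-θ-eq trees α β
realizable? trees α β θ↓  = yes (node α (node β [] ∷ []) , zero , suc zero , refl , refl , refl)
realizable? trees α β θ↑  = yes (node β (node α [] ∷ []) , suc zero , zero , refl , refl , refl)
realizable? trees α β θ↓↓⁺ =
  yes (node α (node α (node β [] ∷ []) ∷ []) , zero , suc (suc zero) , refl , refl , refl)
realizable? trees α β θ↑↑⁺ =
  yes (node β (node β (node α [] ∷ []) ∷ []) , suc (suc zero) , zero , refl , refl , refl)
realizable? trees α β θ→  = yes (node α (node α [] ∷ node β [] ∷ []) , suc zero , suc (suc zero) , refl , refl , refl)
realizable? trees α β θ←  = yes (node α (node β [] ∷ node α [] ∷ []) , suc (suc zero) , suc zero , refl , refl , refl)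
realizable? trees α β θ⇉⁺ =
  yes (node α (node α [] ∷ node α [] ∷ node β [] ∷ []) , suc zero , suc (suc (suc zero)) , refl , refl , refl)
realizable? trees α β θ⇇⁺ =
  yes (node α (node β [] ∷ node α [] ∷ node α [] ∷ []) , suc (suc (suc zero)) , suc zero , refl , refl , refl)
realizable? trees α β θ≁  =
  yes (node α (node α (node α [] ∷ []) ∷ node α (node β [] ∷ []) ∷ []) ,
       suc (suc zero) , suc (suc (suc (suc zero))) , refl , refl , refl)

-- Entailment is decidable: vacuous if unrealisable, otherwise decided by the
-- realising instance.
entails? : ∀ {p} S (α β : OneType p) θ ψ → Dec (Entails S α β θ ψ)
entails? S α β θ ψ with realizable? S α β θ
... | no unrealizable = yes λ M a b la lb θab → ⊥-elim (unrealizable (M , a , b , la , lb , θab))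
... | yes (M , a , b , refl , refl , θab) with eval (str S M) a b ψ in ψab
...   | true  = yes (entails-from-instance S M a b θ ψ θab ψab)
...   | false = no λ entails → false≢true (trans (sym ψab) (entails M a b refl refl θab))

sumΘβ-mod : ∀ {p} S (sel : Θ S → OneType p → Bool) (f : Θ S → OneType p → ℕ) l (l≥1 : 1 ≤ l) →
  modℕ (sumΘβ S sel (λ θ β → modℕ (f θ β) l l≥1)) l l≥1 ≡ modℕ (sumΘβ S sel f) l l≥1
sumΘβ-mod {p} S sel f (suc d) _ = begin
    sum (concatMap (λ θ → map (λ β → if sel θ β then f θ β % D else 0) types) (allΘ S)) % D
  ≡⟨ cong (λ xs → sum xs % D) (concatMap-cong (λ θ → trans (map-cong (if-% θ) types) (map-∘ types)) (allΘ S)) ⟩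
    sum (concatMap (λ θ → map (_% D) (map (g θ) types)) (allΘ S)) % D
  ≡⟨ cong (λ xs → sum xs % D) (map-concatMap (_% D) (λ θ → map (g θ) types) (allΘ S)) ⟨
    sum (map (_% D) (concatMap (λ θ → map (g θ) types) (allΘ S))) % D
  ≡⟨ sum-mod D (concatMap (λ θ → map (g θ) types) (allΘ S)) ⟩
    sum (concatMap (λ θ → map (g θ) types) (allΘ S)) % D
  ∎
  where
  open ≡-Reasoning
  D : ℕ
  D = suc d
  types : List (OneType p)
  types = allTypes p
  g : Θ S → OneType p → ℕ
  g θ β = if sel θ β then f θ β else 0
  if-% : ∀ θ β → (if sel θ β then f θ β % D else 0) ≡ g θ β % D
  if-% θ β with sel θ β
  ... | true  = refl
  ... | false = refl

module _ {p : ℕ} (S : Setting) (M : Model p S) where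

  private
    𝔐 : Structure p (Nav S)
    𝔐 = str S M

  neighbours : Fin (N 𝔐) → Θ S → OneType p → ℕ
  neighbours v θ β = count (λ w → eval 𝔐 v w (θfml S θ) ∧ (lab 𝔐 w ==ᵗ β))

  private
    guard-∧ : ∀ s a b → (if s then ind (a ∧ b) else 0) ≡ (if a then (if b then ind s else 0) else 0)
    guard-∧ true  true  b = refl
    guard-∧ true  false b = refl
    guard-∧ false true  true  = refl
    guard-∧ false true  false = refl
    guard-∧ false false b = refl

  -- Each w lies in exactly one cell, namely (θ-of v w, lab w).
  cells-of : ∀ (sel : Θ S → OneType p → Bool) v w →
    sum (map (λ θ → sum (map (λ β → if sel θ β then ind (eval 𝔐 v w (θfml S θ) ∧ (lab 𝔐 w ==ᵗ β)) else 0)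
                             (allTypes p))) (allΘ S))
    ≡ ind (sel (θ-of S M v w) (lab 𝔐 w))
  cells-of sel v w = begin
      sum (map (λ θ → sum (map (λ β → if sel θ β then ind (E θ ∧ (lab 𝔐 w ==ᵗ β)) else 0) types)) (allΘ S))
    ≡⟨ sum-cong (λ θ → trans (sum-cong (λ β → guard-∧ (sel θ β) (E θ) (lab 𝔐 w ==ᵗ β)) types)
                             (sum-if (E θ) (h θ) types)) (allΘ S) ⟩
      sum (map (λ θ → if E θ then sum (map (h θ) types) else 0) (allΘ S))
    ≡⟨ sum-cong (λ θ → cong (λ b → if b then sum (map (h θ) types) else 0) (eval-by-θ S M v w (θfml S θ))) (allΘ S) ⟩
      sum (map (λ θ → if evalθ S (lab 𝔐 v) (lab 𝔐 w) θ₀ (θfml S θ) then sum (map (h θ) types) else 0) (allΘ S))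
    ≡⟨ select-Θ S (lab 𝔐 v) (lab 𝔐 w) θ₀ (λ θ → sum (map (h θ) types)) ⟩
      sum (map (h θ₀) types)
    ≡⟨ select-type (lab 𝔐 w) (λ β → ind (sel θ₀ β)) ⟩
      ind (sel θ₀ (lab 𝔐 w))
    ∎
    where
    open ≡-Reasoning
    types : List (OneType p)
    types = allTypes p
    θ₀ : Θ S
    θ₀ = θ-of S M v w
    E : Θ S → Bool
    E θ = eval 𝔐 v w (θfml S θ)
    h : Θ S → OneType p → ℕ
    h θ β = if lab 𝔐 w ==ᵗ β then ind (sel θ β) else 0

  count-by-cells : ∀ (sel : Θ S → OneType p → Bool) v →
    sumΘβ S sel (neighbours v) ≡ count (λ w → sel (θ-of S M v w) (lab 𝔐 w))
  count-by-cells sel v = begin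
      sumΘβ S sel (neighbours v)
    ≡⟨ sum-concatMap _ (allΘ S) ⟩
      sum (map (λ θ → sum (map (λ β → if sel θ β then sum (map (F θ β) Ws) else 0) types)) (allΘ S))
    ≡⟨ sum-cong (λ θ → sum-cong (λ β → sum-if (sel θ β) (F θ β) Ws) types) (allΘ S) ⟨
      sum (map (λ θ → sum (map (λ β → sum (map (λ w → if sel θ β then F θ β w else 0) Ws)) types)) (allΘ S))
    ≡⟨ sum-cong (λ θ → sum-swap (λ β w → if sel θ β then F θ β w else 0) types Ws) (allΘ S) ⟩
      sum (map (λ θ → sum (map (λ w → sum (map (λ β → if sel θ β then F θ β w else 0) types)) Ws)) (allΘ S))
    ≡⟨ sum-swap (λ θ w → sum (map (λ β → if sel θ β then F θ β w else 0) types)) (allΘ S) Ws ⟩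
      sum (map (λ w → sum (map (λ θ → sum (map (λ β → if sel θ β then F θ β w else 0) types)) (allΘ S))) Ws)
    ≡⟨ sum-cong (cells-of sel v) Ws ⟩
      count (λ w → sel (θ-of S M v w) (lab 𝔐 w))
    ∎
    where
    open ≡-Reasoning
    types : List (OneType p)
    types = allTypes p
    Ws : List (Fin (N 𝔐))
    Ws = allFin (N 𝔐)
    F : Θ S → OneType p → Fin (N 𝔐) → ℕ
    F θ β w = ind (eval 𝔐 v w (θfml S θ) ∧ (lab 𝔐 w ==ᵗ β))

module _ {p : ℕ} (S : Setting) (φ : NF p S) (M : Model p S) where

  private
    𝔐 : Structure p (Nav S)
    𝔐 = str S M

  nonzero-counter : ∀ v θ β → NonZeroTuple (fullType φ M v θ β) → ¬ neighbours S M v θ β ≡ 0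
  nonzero-counter v θ β (inj₁ c) W≡0 rewrite W≡0 = false≢true c
  nonzero-counter v θ β (inj₂ (j , πj≢0)) W≡0 rewrite W≡0 = πj≢0 (mod-zero (l φ j) (l≥1 φ j))
    where
    mod-zero : ∀ l (l≥1 : 1 ≤ l) → modℕ 0 l l≥1 ≡ 0
    mod-zero (suc l) _ = refl

  nonzero⇒neighbour : ∀ v θ β → NonZeroTuple (fullType φ M v θ β) →
    ∃ λ w → eval 𝔐 v w (θfml S θ) ≡ true × lab 𝔐 w ≡ β
  nonzero⇒neighbour v θ β nz with count-witness _ (nonzero-counter v θ β nz)
  ... | w , e = w , ∧-fst {eval 𝔐 v w (θfml S θ)} e , ==ᵗ-sound (∧-snd {eval 𝔐 v w (θfml S θ)} e)

  neighbour⇒occupied : ∀ v θ w → eval 𝔐 v w (θfml S θ) ≡ true → proj₁ (fullType φ M v θ (lab 𝔐 w)) ≡ true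
  neighbour⇒occupied v θ w θvw = occupied (neighbours S M v θ (lab 𝔐 w))
    (count-positive _ w (∧-intro θvw (==ᵗ-refl (lab 𝔐 w))))
    where
    occupied : ∀ n → ¬ n ≡ 0 → not (n ≡ᵇ 0) ≡ true
    occupied zero    n≢0 = ⊥-elim (n≢0 refl)
    occupied (suc n) _   = refl

  own-type : ∀ v α → proj₁ (fullType φ M v (θ-eq S) α) ≡ true → lab 𝔐 v ≡ α
  own-type v α occ with nonzero⇒neighbour v (θ-eq S) α (inj₁ occ)
  ... | w , v=w , lw = trans (cong (lab 𝔐) (finEq-sound v w (trans (sym (eval-θ-eq S M v w)) v=w))) lw

  own-type-occupied : ∀ v → proj₁ (fullType φ M v (θ-eq S) (lab 𝔐 v)) ≡ true
  own-type-occupied v = neighbour⇒occupied v (θ-eq S) v (trans (eval-θ-eq S M v v) (finEq-refl v))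

  selection-agrees : ∀ v ψ (d : ∀ θ β → Dec (Entails S (lab 𝔐 v) β θ ψ)) w →
    does (d (θ-of S M v w) (lab 𝔐 w)) ≡ eval 𝔐 v w ψ
  selection-agrees v ψ d w with d (θ-of S M v w) (lab 𝔐 w)
  ... | yes entails = sym (entails M v w refl refl (θ-of-holds S M v w))
  ... | no ¬entails with eval 𝔐 v w ψ in ψvw
  ...   | false = refl
  ...   | true  =
    ⊥-elim (¬entails (entails-from-instance S M v w (θ-of S M v w) ψ (θ-of-holds S M v w) ψvw))

  modular-count : ∀ j v ψ (d : ∀ θ β → Dec (Entails S (lab 𝔐 v) β θ ψ)) →
    modℕ (sumΘβ S (λ θ β → does (d θ β)) (λ θ β → proj₂ (fullType φ M v θ β) j)) (l φ j) (l≥1 φ j)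
    ≡ modℕ (count (λ w → eval 𝔐 v w ψ)) (l φ j) (l≥1 φ j)
  modular-count j v ψ d = begin
      modℕ (sumΘβ S sel (λ θ β → modℕ (neighbours S M v θ β) (l φ j) (l≥1 φ j))) (l φ j) (l≥1 φ j)
    ≡⟨ sumΘβ-mod S sel (neighbours S M v) (l φ j) (l≥1 φ j) ⟩
      modℕ (sumΘβ S sel (neighbours S M v)) (l φ j) (l≥1 φ j)
    ≡⟨ cong (λ n → modℕ n (l φ j) (l≥1 φ j))
            (trans (count-by-cells S M sel v) (count-cong (selection-agrees v ψ d))) ⟩
      modℕ (count (λ w → eval 𝔐 v w ψ)) (l φ j) (l≥1 φ j)
    ∎
    where
    open ≡-Reasoning
    sel : Θ S → OneType p → Bool
    sel θ β = does (d θ β)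

  -- M ⊨ φ makes every realised full type consistent: each consistency
  -- condition is witnessed inside M and transferred by entails-from-instance.
  sound : M ⊨ φ → ∀ v → Consistent φ (fullType φ M v)
  sound (universal , existential , modular) v α occ with own-type v α occ
  ... | refl = universal′ , existential′ , modular′
    where
    universal′ : ∀ θ β → NonZeroTuple (fullType φ M v θ β) → Entails S (lab 𝔐 v) β θ (χ φ)
    universal′ θ β nz with nonzero⇒neighbour v θ β nz
    ... | w , θvw , refl = entails-from-instance S M v w θ (χ φ) θvw (universal v w)
    existential′ : ∀ i → Σ (Θ S) λ θ → Σ (OneType p) λ β →
                   NonZeroTuple (fullType φ M v θ β) × Entails S (lab 𝔐 v) β θ (χs φ i)
    existential′ i with existential i v
    ... | w , χi = θ-of S M v w , lab 𝔐 w , inj₁ (neighbour⇒occupied v _ w (θ-of-holds S M v w)) ,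
                   entails-from-instance S M v w _ (χs φ i) (θ-of-holds S M v w) χi
    modular′ : ∀ j (d : ∀ θ β → Dec (Entails S (lab 𝔐 v) β θ (ψ φ j))) →
      cmpHolds (cmp φ j)
        (modℕ (sumΘβ S (λ θ β → does (d θ β)) (λ θ β → proj₂ (fullType φ M v θ β) j)) (l φ j) (l≥1 φ j))
        (k φ j)
    modular′ j d = subst (λ n → cmpHolds (cmp φ j) n (k φ j)) (sym (modular-count j v (ψ φ j) d)) (modular j v)

  -- Consistency of the full types of all v gives the three conjuncts of φ,
  -- each consistency condition being applied at α = tp(v).
  complete : (∀ v → Consistent φ (fullType φ M v)) → M ⊨ φ
  complete consistent = universal , existential , modular
    where
    universal : ∀ a b → eval 𝔐 a b (χ φ) ≡ true
    universal a b = proj₁ (consistent a (lab 𝔐 a) (own-type-occupied a)) (θ-of S M a b) (lab 𝔐 b)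
      (inj₁ (neighbour⇒occupied a _ b (θ-of-holds S M a b))) M a b refl refl (θ-of-holds S M a b)
    existential : ∀ i a → ∃ λ b → eval 𝔐 a b (χs φ i) ≡ true
    existential i a with proj₁ (proj₂ (consistent a (lab 𝔐 a) (own-type-occupied a))) i
    ... | θ , β , nz , entails with nonzero⇒neighbour a θ β nz
    ... | w , θaw , lw = w , entails M a w refl lw θaw
    modular : ∀ j a → cmpHolds (cmp φ j) (modℕ (count (λ b → eval 𝔐 a b (ψ φ j))) (l φ j) (l≥1 φ j)) (k φ j)
    modular j a = subst (λ n → cmpHolds (cmp φ j) n (k φ j)) (modular-count j a (ψ φ j) d)
                        (proj₂ (proj₂ (consistent a (lab 𝔐 a) (own-type-occupied a))) j d)
      where
      d : ∀ θ β → Dec (Entails S (lab 𝔐 a) β θ (ψ φ j))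
      d θ β = entails? S (lab 𝔐 a) β θ (ψ φ j)

lemma6 : ∀ {p : ℕ} (S : Setting) (φ : NF p S) (M : Model p S) →
    (M ⊨ φ) ⇔ (∀ (v : Fin (N (str S M))) → Consistent φ (fullType φ M v))
lemma6 S φ M = mk⇔ (sound S φ M) (complete S φ M)
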